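{- Let $k$ and $w$ be positive integers and let $(A,B,C)$ be a partition of the vertex set of a graph $G$ such that there are no edges between $A$ and $C$ and $|B| = w$. If $H$ is the $k$-power of $G$, then $\mathrm{mim}_H(A\cup B)\le w$.
   Context: The $k$-power of $G$ is the graph on $V(G)$ in which distinct $u,v$ are adjacent iff their distance in $G$ is at most $k$. For $X\subseteq V(H)$, $\mathrm{mim}_H(X)$ is the maximum size of an induced matching in the bipartite graph $H[X, V(H)\setminus X]$ whose parts are $X$ and $V(H)\setminus X$ and whose edges are the edges of $H$ with one endpoint in each part. -}

module Defs where

open import Data.Nat using (ℕ; zero; suc; _≤_; _+_)
open import Data.Nat.Properties using (+-suc; +-identityʳ)
open import Data.Fin using (Fin)
open import Data.List using (List; length; map)
open import Data.List.Relation.Unary.All using (All)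
open import Data.List.Relation.Unary.AllPairs using (AllPairs)
open import Data.Product using (Σ; _×_; _,_; ∃-syntax; proj₁; proj₂)
open import Relation.Binary.PropositionalEquality using (_≡_; _≢_; refl; subst; sym)
open import Relation.Nullary using (¬_)

record Graph (n : ℕ) : Set₁ where
  field
    Adj       : Fin n → Fin n → Set
    Adj-irr   : ∀ {u} → ¬ Adj u u
    Adj-sym   : ∀ {u v} → Adj u v → Adj v u
open Graph public

data Walk {n : ℕ} (G : Graph n) : Fin n → Fin n → ℕ → Set where
  here : ∀ {u} → Walk G u u zero
  step : ∀ {u v w ℓ} → Adj G u v → Walk G v w ℓ → Walk G u w (suc ℓ)

DistLe : ∀ {n} → Graph n → ℕ → Fin n → Fin n → Set
DistLe G k u v = ∃[ ℓ ] (ℓ ≤ k × Walk G u v ℓ)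

walk-rev-acc : ∀ {n} (G : Graph n) {u v w a b} →
               Walk G u v a → Walk G u w b → Walk G v w (a + b)
walk-rev-acc G here acc = acc
walk-rev-acc G {b = b} (step {ℓ = ℓ} e p) acc =
  subst (Walk G _ _) (+-suc ℓ b) (walk-rev-acc G p (step (Adj-sym G e) acc))

walk-rev : ∀ {n} (G : Graph n) {u v a} → Walk G u v a → Walk G v u a
walk-rev G {a = a} p = subst (Walk G _ _) (+-identityʳ a) (walk-rev-acc G p here)

power : ∀ {n} → Graph n → ℕ → Graph n
power G k = record
  { Adj     = λ u v → u ≢ v × DistLe G k u v
  ; Adj-irr = λ p → proj₁ p refl
  ; Adj-sym = λ { (u≢v , (ℓ , ℓ≤k , p)) → (λ e → u≢v (sym e)) , (ℓ , ℓ≤k , walk-rev G p) }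
  }

-- An induced matching in the bipartite graph H[X, V(H) ∖ X], where X is
-- given as a predicate on vertices. It is a list of edges (x , y) with
-- x ∈ X, y ∉ X, x ~_H y, all endpoints pairwise distinct, and no edge of
-- H[X, V∖X] between x_i and y_j for i ≠ j (the only edges of the bipartite
-- graph possibly joining endpoints of two matching edges).
record InducedMatching {n : ℕ} (H : Graph n) (X : Fin n → Set) : Set where
  field
    edges    : List (Fin n × Fin n)
    inX      : All (λ e → X (proj₁ e)) edges
    notInX   : All (λ e → ¬ X (proj₂ e)) edges
    isEdge   : All (λ e → Adj H (proj₁ e) (proj₂ e)) edges
    distinct : AllPairs (λ e f → proj₁ e ≢ proj₁ f × proj₂ e ≢ proj₂ f) edges
    induced  : AllPairs (λ e f → ¬ Adj H (proj₁ e) (proj₂ f) × ¬ Adj H (proj₁ f) (proj₂ e)) edges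
  size : ℕ
  size = length edges

MimLe : ∀ {n} → Graph n → (Fin n → Set) → ℕ → Set
MimLe H X w = (M : InducedMatching H X) → InducedMatching.size M ≤ w

-- A partition (A , B , C) of the vertex set, recorded as a labelling.
data Part : Set where
  pA pB pC : Part

open import Data.Fin.Subset using (Subset; ∣_∣)
open import Data.Vec using (tabulate)
open import Data.Bool using (Bool; true; false)

isB : Part → Bool
isB pB = true
isB pA = false
isB pC = false

partB : ∀ {n} → (Fin n → Part) → Subset n
partB part = tabulate (λ v → isB (part v))

InAB : ∀ {n} → (Fin n → Part) → Fin n → Set
InAB part v = part v ≢ pC

module Submission where

-- Let (x , y) be an edge of H = G^k with x ∈ A ∪ B and y ∈ C.
-- A walk of length ≤ k from x to y must enter B before it can reach C,
-- since G has no A–C edges; so the edge is routed through some b ∈ B,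
-- i.e. there are walks x → b and b → y of total length ≤ k.  If two
-- edges (x₁ , y₁) and (x₂ , y₂) of an induced matching were routed
-- through the same b, with segment lengths a₁ + c₁ ≤ k and a₂ + c₂ ≤ k,
-- then, say a₁ ≤ a₂, the walk x₁ → b → y₂ has length a₁ + c₂ ≤ k, so
-- x₁ y₂ would be an edge of H and the matching would not be induced.
-- Hence choosing a routing vertex for every matching edge is injective
-- into B, and a pigeonhole count gives size ≤ |B| = w.

open import Defs
open import Data.Nat using (ℕ; _≤_; _≥_; suc; _+_; s≤s; z≤n)
open import Data.Nat.Properties using (≤-refl; ≤-trans; ≤-total; +-monoˡ-≤)
open import Data.Fin using (Fin)
open import Data.Fin.Subset using (Subset; _∈_; _-_; ∣_∣)
open import Data.Fin.Subset.Properties using (x∈p⇒∣p-x∣<∣p∣; x∈p∧x≢y⇒x∈p-y)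
open import Data.Vec.Properties using (lookup∘tabulate; lookup⇒[]=)
open import Data.List using (List; []; _∷_; length)
open import Data.List.Relation.Unary.All as All using (All; []; _∷_)
open import Data.List.Relation.Unary.AllPairs as AllPairs using (AllPairs; []; _∷_)
open import Data.Product using (_×_; _,_; proj₁; proj₂; ∃-syntax)
open import Data.Sum using (_⊎_; inj₁; inj₂; [_,_]′)
open import Data.Empty using (⊥-elim)
open import Relation.Binary.PropositionalEquality using (_≡_; _≢_; refl; trans; cong)
open import Relation.Nullary using (¬_)

_++ʷ_ : ∀ {n} {G : Graph n} {x b y a c} → Walk G x b a → Walk G b y c → Walk G x y (a + c)
here       ++ʷ q = q
(step e p) ++ʷ q = step e (p ++ʷ q)

record Via {n} (G : Graph n) (ℓ : ℕ) (x b y : Fin n) : Set where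
  constructor via
  field
    {before after} : ℕ
    bounded        : before + after ≤ ℓ
    toB            : Walk G x b before
    fromB          : Walk G b y after

via-step : ∀ {n} {G : Graph n} {ℓ x v b y} → Adj G x v → Via G ℓ v b y → Via G (suc ℓ) x b y
via-step e (via bd p q) = via (s≤s bd) (step e p) q

via-weaken : ∀ {n} {G : Graph n} {ℓ k x b y} → ℓ ≤ k → Via G ℓ x b y → Via G k x b y
via-weaken ℓ≤k (via bd p q) = via (≤-trans bd ℓ≤k) p q

-- Shortcut: two routes of length ≤ k through the same vertex b can be
-- recombined, so that x₁ reaches y₂ or x₂ reaches y₁ within distance k
-- (use the shorter of the two initial segments).
shortcut : ∀ {n} {G : Graph n} {k x₁ y₁ x₂ y₂ b} →
           Via G k x₁ b y₁ → Via G k x₂ b y₂ → DistLe G k x₁ y₂ ⊎ DistLe G k x₂ y₁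
shortcut {k = k} (via {a₁} {c₁} bd₁ p₁ q₁) (via {a₂} {c₂} bd₂ p₂ q₂) with ≤-total a₁ a₂
... | inj₁ a₁≤a₂ = inj₁ (_ , ≤-trans (+-monoˡ-≤ c₂ a₁≤a₂) bd₂ , p₁ ++ʷ q₂)
... | inj₂ a₂≤a₁ = inj₂ (_ , ≤-trans (+-monoˡ-≤ c₁ a₂≤a₁) bd₁ , p₂ ++ʷ q₁)

-- Each item removes its element from p.
pigeonhole : ∀ {n} {X : Set} {R : X → Fin n → Set} (p : Subset n) (es : List X) →
             All (λ e → ∃[ b ] b ∈ p × R e b) es →
             AllPairs (λ e f → ∀ {b} → R e b → ¬ R f b) es →
             length es ≤ ∣ p ∣
pigeonhole p [] [] [] = z≤n
pigeonhole {R = R} p (e ∷ es) ((b , b∈p , Reb) ∷ assigned) (exclusive ∷ pairs) =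
  ≤-trans (s≤s (pigeonhole (p - b) es (All.zipWith shrink (assigned , exclusive)) pairs))
          (x∈p⇒∣p-x∣<∣p∣ b∈p)
  where
    shrink : ∀ {f} → (∃[ b′ ] b′ ∈ p × R f b′) × (∀ {b′} → R e b′ → ¬ R f b′) →
             ∃[ b′ ] b′ ∈ p - b × R f b′
    shrink ((b′ , b′∈p , Rfb′) , excl) = b′ , x∈p∧x≢y⇒x∈p-y b′∈p b′≢b , Rfb′
      where
        b′≢b : b′ ≢ b
        b′≢b refl = excl Reb Rfb′

∈B : ∀ {n} (part : Fin n → Part) {b} → part b ≡ pB → b ∈ partB part
∈B part {b} b∈B = lookup⇒[]= b (partB part) (trans (lookup∘tabulate (λ v → isB (part v)) b) (cong isB b∈B))

∉AB⇒∈C : ∀ {n} (part : Fin n → Part) y → ¬ InAB part y → part y ≡ pC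
∉AB⇒∈C part y y∉AB with part y
... | pA = ⊥-elim (y∉AB (λ ()))
... | pB = ⊥-elim (y∉AB (λ ()))
... | pC = refl

module _ {n : ℕ} (k : ℕ) (G : Graph n) (part : Fin n → Part)
         (noAC : ∀ u v → part u ≡ pA → part v ≡ pC → ¬ Adj G u v) where

  separator : ∀ {x y ℓ} → Walk G x y ℓ → InAB part x → part y ≡ pC →
              ∃[ b ] part b ≡ pB × Via G ℓ x b y
  separator here x∉C y∈C = ⊥-elim (x∉C y∈C)
  separator {x} (step {v = v} e p) x∉C y∈C with part x in px
  ... | pB = x , px , via ≤-refl here (step e p)
  ... | pC = ⊥-elim (x∉C refl)
  ... | pA with separator p v∉C y∈C
    where
      v∉C : InAB part v
      v∉C v∈C = noAC x v px v∈C e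
  ...   | b , b∈B , route = b , b∈B , via-step e route

  record Crossing (e : Fin n × Fin n) (b : Fin n) : Set where
    field
      source∉C : InAB part (proj₁ e)
      target∈C : part (proj₂ e) ≡ pC
      route    : Via G k (proj₁ e) b (proj₂ e)

  crossing : ∀ {x y} → InAB part x → ¬ InAB part y → Adj (power G k) x y →
             ∃[ b ] b ∈ partB part × Crossing (x , y) b
  crossing {y = y} x∉C y∉AB (_ , ℓ , ℓ≤k , w)
    with separator w x∉C (∉AB⇒∈C part y y∉AB)
  ... | b , b∈B , route =
    b , ∈B part b∈B , record { source∉C = x∉C ; target∈C = ∉AB⇒∈C part y y∉AB
                             ; route = via-weaken ℓ≤k route }

  source≢target : ∀ {e f b b′} → Crossing e b → Crossing f b′ → proj₁ e ≢ proj₂ f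
  source≢target ce cf refl = Crossing.source∉C ce (Crossing.target∈C cf)

  crossings-collide : ∀ {e f b} → Crossing e b → Crossing f b →
                      Adj (power G k) (proj₁ e) (proj₂ f) ⊎ Adj (power G k) (proj₁ f) (proj₂ e)
  crossings-collide ce cf with shortcut (Crossing.route ce) (Crossing.route cf)
  ... | inj₁ d = inj₁ (source≢target ce cf , d)
  ... | inj₂ d = inj₂ (source≢target cf ce , d)

lemma2 : (k w n : ℕ) → k ≥ 1 → w ≥ 1 → (G : Graph n) → (part : Fin n → Part) →
         (∀ u v → part u ≡ pA → part v ≡ pC → ¬ Adj G u v) →
         ∣ partB part ∣ ≡ w →
         MimLe (power G k) (InAB part) w
lemma2 k w n _ _ G part noAC refl M =
  pigeonhole (partB part) edges routed exclusive
  where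
    open InducedMatching M

    routed : All (λ e → ∃[ b ] b ∈ partB part × Crossing k G part noAC e b) edges
    routed = All.zipWith (λ { ((x∉C , y∉AB) , xy) → crossing k G part noAC x∉C y∉AB xy })
                         (All.zip (inX , notInX) , isEdge)

    exclusive : AllPairs (λ e f → ∀ {b} → Crossing k G part noAC e b → ¬ Crossing k G part noAC f b) edges
    exclusive = AllPairs.map (λ { (¬ef , ¬fe) ce cf → [ ¬ef , ¬fe ]′ (crossings-collide k G part noAC ce cf) }) induced
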